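{- Let $r\ge 2$ and let $H$ be an $r$-graph with at least $g(r,4)$ edges. Then there is a constant $b=b(H)>0$ such that $C_r(n,H)=\Omega(n^b)$ as $n\to\infty$.
   Context: An $r$-graph is an $r$-uniform hypergraph; $K_n^{(r)}$ is the complete $r$-graph on $n$ vertices. For an $r$-graph $H$, an $(n,r,H)$-local coloring with $k$ colors is a family of $n$ edge-colorings $f_v:E(K_n^{(r)})\to[k]$, one for each vertex $v$ of $K_n^{(r)}$, such that for every copy $T$ of $H$ in $K_n^{(r)}$ there is a vertex $u\in V(T)$ for which $f_u$ is rainbow on $T$ (no two edges of $T$ get the same color under $f_u$). $C_r(n,H)$ is the minimum such $k$. The sunflower $S_r(d,m)$ is the $r$-graph with $m$ edges pairwise intersecting in exactly the same $d$-set (the core). $g(r,m)$ denotes the minimum integer $N$ such that every $r$-graph with at least $N$ edges contains a sunflower $S_r(d,m)$ for some $0\le d\le r-1$ (it is known that $(m-1)^r\le g(r,m)\le (m-1)^r r!+1$). -}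

module Defs where

open import Data.Nat using (ℕ; zero; suc; _≤_; _<_)
open import Data.Fin using (Fin; zero; suc)
open import Data.Fin.Subset using (Subset; ∣_∣; _∩_; _∪_; ⊥; ⁅_⁆)
open import Data.Vec using (_∷_; [])
open import Data.Bool using (true; false)
open import Data.List using (List; length; lookup)
open import Data.List.Relation.Unary.All using (All)
open import Data.List.Membership.Propositional using (_∈_)
open import Data.List.Relation.Unary.Unique.Propositional using (Unique)
open import Data.Product using (Σ; ∃; _×_)
open import Relation.Binary.PropositionalEquality using (_≡_; _≢_)
open import Function.Definitions using (Injective)

record Hypergraph (r : ℕ) : Set where
  field
    nV       : ℕ
    edges    : List (Subset nV)
    uniform  : All (λ e → ∣ e ∣ ≡ r) edges
    distinct : Unique edges
open Hypergraph public

e[_] : ∀ {r} → Hypergraph r → ℕ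
e[ G ] = length (edges G)

-- G contains a sunflower S_r(d,m) with d-element core C:
-- m edges of G whose pairwise intersections all equal C.
-- (Since |C| = d < r, such edges are automatically distinct.)
ContainsSunflowerWithCore : ∀ {r} → (d m : ℕ) → Hypergraph r → Set
ContainsSunflowerWithCore d m G =
  Σ (Subset (nV G)) λ C → ∣ C ∣ ≡ d ×
  Σ (Fin m → Subset (nV G)) λ pet →
    (∀ i → pet i ∈ edges G) ×
    (∀ i j → i ≢ j → (pet i ∩ pet j) ≡ C)

ContainsSunflower : ∀ {r} → ℕ → Hypergraph r → Set
ContainsSunflower {r} m G = ∃ λ d → d < r × ContainsSunflowerWithCore d m G

ForcesSunflower : ℕ → ℕ → ℕ → Set
ForcesSunflower r m N = (G : Hypergraph r) → N ≤ e[ G ] → ContainsSunflower m G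

IsG : ℕ → ℕ → ℕ → Set
IsG r m N = ForcesSunflower r m N × (∀ N' → ForcesSunflower r m N' → N ≤ N')

image : ∀ {a b} → (Fin a → Fin b) → Subset a → Subset b
image {zero}  φ []          = ⊥
image {suc a} φ (true ∷ s)  = ⁅ φ zero ⁆ ∪ image (λ x → φ (suc x)) s
image {suc a} φ (false ∷ s) = image (λ x → φ (suc x)) s

Rainbow : ∀ {r n k} (H : Hypergraph r) → (Fin (nV H) → Fin n) → (Subset n → Fin k) → Set
Rainbow H φ c = ∀ (i j : Fin (length (edges H))) → i ≢ j →
  c (image φ (lookup (edges H) i)) ≢ c (image φ (lookup (edges H) j))

-- An (n,r,H)-local colouring with k colours: one edge-colouring f v of K_n^(r)
-- per vertex v (given on all subsets of Fin n; only r-subsets matter), such that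
-- for every copy of H (an injective embedding φ : V(H) → [n]) some vertex u = φ x
-- of the copy has f u rainbow on the copy.
LocalColoring : ∀ {r} (H : Hypergraph r) (n k : ℕ) → Set
LocalColoring H n k =
  Σ (Fin n → Subset n → Fin k) λ f →
    ∀ (φ : Fin (nV H) → Fin n) → Injective _≡_ _≡_ φ →
      ∃ λ (x : Fin (nV H)) → Rainbow H φ (f (φ x))

{-# OPTIONS --safe #-}
-- H contains a sunflower with edges e₀, …, e₃ and core C; call eσ ∖ C the petal of eσ.
-- View K_n as a base copy of V(H) followed by M blocks of h = |V(H)| vertices. For an
-- injective choice J of four blocks, embed H by sending the vertices outside all petals
-- to the base and the petal of eσ, in rank order, to block J σ; the image of eσ then
-- depends only on the block J σ. Two rounds of pigeonhole over the colour patterns a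
-- vertex sees (k^h possibilities each) produce a J for which every vertex of the copy
-- colours the images of two of the eσ alike, so no vertex is rainbow. Hence a local
-- colouring forces n < (M + 1) h, and M is polynomial in k^h, giving n ≤ (8hk)^(5h).
module Submission where

open import Data.Empty using (⊥-elim)
open import Data.Fin
  using (Fin; zero; suc; combine; _↑ˡ_; _↑ʳ_; splitAt; fromℕ<; toℕ; inject≤; funToFin; finToFun)
open import Data.Fin.Patterns using (0F; 1F; 2F; 3F)
import Data.Fin.Properties as Fin
open import Data.Fin.Properties
  using (pigeonhole; combine-injective; finToFun-funToFin; <⇒≢; ↑ˡ-injective; ↑ʳ-injective;
         splitAt-↑ˡ; splitAt-↑ʳ; inject≤-injective; toℕ-fromℕ<; fromℕ<-cong; _≟_; any?; nonZeroIndex)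
open import Data.Fin.Subset using (Subset; ∣_∣; _∩_; _─_; ⁅_⁆; _∈_; _∉_; _⊆_; inside; outside)
open import Data.Fin.Subset.Properties
  using (x∈p∪q⁺; x∈p∪q⁻; x∈⁅x⁆; x∈⁅y⁆⇒x≡y; ∉⊥; x∈p∩q⁺; x∈p∩q⁻; ⊆-antisym; ∣p∣≤n; _∈?_;
         ∩-idem; x∈p∧x∉q⇒x∈p─q; p─q⊆p; p∩q⊆q)
open import Data.List using (lookup)
open import Data.List.Membership.Propositional using () renaming (_∈_ to _∈ₗ_)
open import Data.List.Relation.Unary.All as All using ()
open import Data.List.Relation.Unary.Any as Any using ()
open import Data.List.Relation.Unary.Any.Properties using (lookup-index)
open import Data.Nat using (ℕ; zero; suc; _+_; _*_; _^_; _≤_; _<_; z≤n; s≤s; NonZero; >-nonZero⁻¹)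
open import Data.Nat.Properties
  using (≤-refl; ≤-trans; <-≤-trans; <⇒≤; ≰⇒>; n<1+n; suc-injective; +-cancelˡ-≡; +-suc; <-irrefl;
         *-comm; *-assoc; *-monoˡ-≤; *-monoʳ-≤; m≤m+n; m≤m*n; m^n≢0; m^n>0; ^-*-assoc; ^-identityʳ;
         [m*n]*[o*p]≡[m*o]*[n*p]; module ≤-Reasoning)
open import Data.Nat.Tactic.RingSolver using (solve-∀)
open import Data.Product using (Σ; ∃; ∃₂; _×_; _,_; proj₁; proj₂; uncurry)
open import Data.Sum using (inj₁; inj₂)
open import Data.Vec using (Vec; _∷_; []; here; there) renaming (lookup to lookupᵥ)
open import Data.Vec.Relation.Unary.All using ([]; _∷_)
open import Data.Vec.Relation.Unary.AllPairs using ([]; _∷_)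
open import Data.Vec.Relation.Unary.Unique.Propositional using (Unique)
open import Data.Vec.Relation.Unary.Unique.Propositional.Properties using (lookup-injective)
open import Function using (_∘_)
open import Function.Definitions using (Injective)
open import Relation.Binary.PropositionalEquality
  using (_≡_; _≢_; _≗_; refl; sym; trans; cong; cong₂; subst; subst₂; module ≡-Reasoning)
open import Relation.Nullary using (¬_; yes; no)

open import Defs

x∈image⁺ : ∀ {a b} (φ : Fin a → Fin b) {p : Subset a} {x} → x ∈ p → φ x ∈ image φ p
x∈image⁺ φ {inside ∷ p}  here        = x∈p∪q⁺ (inj₁ (x∈⁅x⁆ (φ zero)))
x∈image⁺ φ {inside ∷ p}  (there x∈p) = x∈p∪q⁺ {p = ⁅ φ zero ⁆} (inj₂ (x∈image⁺ (φ ∘ suc) x∈p))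
x∈image⁺ φ {outside ∷ p} (there x∈p) = x∈image⁺ (φ ∘ suc) x∈p

x∈image⁻ : ∀ {a b} (φ : Fin a → Fin b) {p : Subset a} {y} → y ∈ image φ p → ∃ λ x → x ∈ p × φ x ≡ y
x∈image⁻ {zero}  φ {[]}          y∈ = ⊥-elim (∉⊥ y∈)
x∈image⁻ {suc a} φ {inside ∷ p}  y∈ with x∈p∪q⁻ ⁅ φ zero ⁆ (image (φ ∘ suc) p) y∈
... | inj₁ y∈⁅φ0⁆ = zero , here , sym (x∈⁅y⁆⇒x≡y _ y∈⁅φ0⁆)
... | inj₂ y∈img with x∈image⁻ (φ ∘ suc) y∈img
...   | x , x∈p , φx≡y = suc x , there x∈p , φx≡y
x∈image⁻ {suc a} φ {outside ∷ p} y∈ with x∈image⁻ (φ ∘ suc) y∈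
... | x , x∈p , φx≡y = suc x , there x∈p , φx≡y

x∈p─q⇒x∉q : ∀ {n} (p q : Subset n) {x} → x ∈ p ─ q → x ∉ q
x∈p─q⇒x∉q (_ ∷ p) (outside ∷ q) (there x∈) (there x∈q) = x∈p─q⇒x∉q p q x∈ x∈q
x∈p─q⇒x∉q (_ ∷ p) (inside ∷ q)  (there x∈) (there x∈q) = x∈p─q⇒x∉q p q x∈ x∈q

∣p∣≡∣p∩q∣+∣p─q∣ : ∀ {n} (p q : Subset n) → ∣ p ∣ ≡ ∣ p ∩ q ∣ + ∣ p ─ q ∣
∣p∣≡∣p∩q∣+∣p─q∣ []            []            = refl
∣p∣≡∣p∩q∣+∣p─q∣ (inside ∷ p)  (inside ∷ q)  = cong suc (∣p∣≡∣p∩q∣+∣p─q∣ p q)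
∣p∣≡∣p∩q∣+∣p─q∣ (inside ∷ p)  (outside ∷ q) = trans (cong suc (∣p∣≡∣p∩q∣+∣p─q∣ p q)) (sym (+-suc _ _))
∣p∣≡∣p∩q∣+∣p─q∣ (outside ∷ p) (inside ∷ q)  = ∣p∣≡∣p∩q∣+∣p─q∣ p q
∣p∣≡∣p∩q∣+∣p─q∣ (outside ∷ p) (outside ∷ q) = ∣p∣≡∣p∩q∣+∣p─q∣ p q

rank : ∀ {n} → Subset n → Fin n → ℕ
rank (_ ∷ p)       zero    = 0
rank (inside ∷ p)  (suc x) = suc (rank p x)
rank (outside ∷ p) (suc x) = rank p x

rank<∣p∣ : ∀ {n} {p : Subset n} {x} → x ∈ p → rank p x < ∣ p ∣
rank<∣p∣ {p = inside ∷ p}  here        = s≤s z≤n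
rank<∣p∣ {p = inside ∷ p}  (there x∈p) = s≤s (rank<∣p∣ x∈p)
rank<∣p∣ {p = outside ∷ p} (there x∈p) = rank<∣p∣ x∈p

rank-injective : ∀ {n} {p : Subset n} {x y} → x ∈ p → y ∈ p → rank p x ≡ rank p y → x ≡ y
rank-injective {p = inside ∷ p}  here        here        _  = refl
rank-injective {p = inside ∷ p}  here        (there _)   ()
rank-injective {p = inside ∷ p}  (there _)   here        ()
rank-injective {p = inside ∷ p}  (there x∈p) (there y∈p) eq = cong suc (rank-injective x∈p y∈p (suc-injective eq))
rank-injective {p = outside ∷ p} (there x∈p) (there y∈p) eq = cong suc (rank-injective x∈p y∈p eq)

rank-surjective : ∀ {n} (p : Subset n) {t} → t < ∣ p ∣ → ∃ λ x → x ∈ p × rank p x ≡ t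
rank-surjective (inside ∷ p)  {zero}  _         = zero , here , refl
rank-surjective (inside ∷ p)  {suc t} (s≤s t<) with rank-surjective p t<
... | x , x∈p , rank≡t = suc x , there x∈p , cong suc rank≡t
rank-surjective (outside ∷ p) t< with rank-surjective p t<
... | x , x∈p , rank≡t = suc x , there x∈p , rank≡t

funToFin-injective : ∀ {h k} (f g : Fin h → Fin k) → funToFin f ≡ funToFin g → f ≗ g
funToFin-injective f g eq t = begin
  f t                    ≡⟨ finToFun-funToFin f t ⟨
  finToFun (funToFin f) t ≡⟨ cong (λ c → finToFun c t) eq ⟩
  finToFun (funToFin g) t ≡⟨ finToFun-funToFin g t ⟩
  g t                    ∎
  where open ≡-Reasoning

pigeonhole-≗ : ∀ {h k m} → k ^ h < m → (f : Fin m → Fin h → Fin k) → ∃₂ λ i j → i ≢ j × f i ≗ f j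
pigeonhole-≗ kʰ<m f with pigeonhole kʰ<m (funToFin ∘ f)
... | i , j , i<j , eq = i , j , <⇒≢ i<j , funToFin-injective (f i) (f j) eq

↑ˡ≢↑ʳ : ∀ {m n} (i : Fin m) (j : Fin n) → i ↑ˡ n ≢ m ↑ʳ j
↑ˡ≢↑ʳ {m} {n} i j eq with trans (sym (splitAt-↑ˡ m i n)) (trans (cong (splitAt m) eq) (splitAt-↑ʳ m n j))
... | ()

opposite₁ opposite₂ : Fin 4 → Fin 4
opposite₁ 0F = 2F
opposite₁ 1F = 2F
opposite₁ 2F = 0F
opposite₁ 3F = 0F
opposite₂ 0F = 3F
opposite₂ 1F = 3F
opposite₂ 2F = 1F
opposite₂ 3F = 1F

opposite₁≢opposite₂ : ∀ σ → opposite₁ σ ≢ opposite₂ σ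
opposite₁≢opposite₂ 0F ()
opposite₁≢opposite₂ 1F ()
opposite₁≢opposite₂ 2F ()
opposite₁≢opposite₂ 3F ()

-- F x j is the colour that base vertex x gives the edge placed on block j, and G i t j
-- the colour that vertex t of block i gives it. The blocks J 0, J 1 and J 2, J 3 form
-- two pairs, and opposite₁ σ, opposite₂ σ is the pair not containing σ.
record Trap {k h M : ℕ} (F : Fin h → Fin M → Fin k) (G : Fin M → Fin h → Fin M → Fin k) : Set where
  field
    J           : Fin 4 → Fin M
    J-injective : Injective _≡_ _≡_ J
    base-blind  : ∀ x → F x (J 2F) ≡ F x (J 3F)
    block-blind : ∀ σ t → G (J σ) t (J (opposite₁ σ)) ≡ G (J σ) t (J (opposite₂ σ))

module TrapConstruction {k h S W : ℕ} (kʰ<S : k ^ h < S)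
  (F : Fin h → Fin (S + W) → Fin k) (G : Fin (S + W) → Fin h → Fin (S + W) → Fin k) where

  left : Fin S → Fin (S + W)
  left a = a ↑ˡ W

  right : Fin W → Fin (S + W)
  right w = S ↑ʳ w

  twins : ∀ w → ∃₂ λ a b → a ≢ b × (λ t → G (right w) t (left a)) ≗ (λ t → G (right w) t (left b))
  twins w = pigeonhole-≗ kʰ<S (λ a t → G (right w) t (left a))

  twin₁ twin₂ : Fin W → Fin S
  twin₁ w = proj₁ (twins w)
  twin₂ w = proj₁ (proj₂ (twins w))

  twins-≢ : ∀ w → twin₁ w ≢ twin₂ w
  twins-≢ w = proj₁ (proj₂ (proj₂ (twins w)))

  twins-alike : ∀ w t → G (right w) t (left (twin₁ w)) ≡ G (right w) t (left (twin₂ w))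
  twins-alike w = proj₂ (proj₂ (proj₂ (twins w)))

  -- Right blocks with equal profiles have the same twins and are coloured alike by the
  -- base and by both twins.
  profile : Fin W → Fin (S * (S * (k ^ h * (k ^ h * k ^ h))))
  profile w =
    combine (twin₁ w) (combine (twin₂ w) (combine (funToFin (λ x → F x (right w)))
      (combine (funToFin (λ t → G (left (twin₁ w)) t (right w)))
               (funToFin (λ t → G (left (twin₂ w)) t (right w))))))

  trap-from : ∀ w w' → w ≢ w' → profile w ≡ profile w' → Trap F G
  trap-from w w' w≢w' same
    with combine-injective _ _ _ _ same
  ... | a≡ , same₁ with combine-injective _ _ _ _ same₁
  ... | b≡ , same₂ with combine-injective _ _ _ _ same₂
  ... | F≡ , same₃ with combine-injective _ _ _ _ same₃
  ... | Ga≡ , Gb≡ = record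
    { J           = lookupᵥ quad
    ; J-injective = λ {σ} {σ'} → lookup-injective quad-unique σ σ'
    ; base-blind  = funToFin-injective _ _ F≡
    ; block-blind = blind
    }
    where
    a b : Fin S
    a = twin₁ w
    b = twin₂ w
    quad : Vec (Fin (S + W)) 4
    quad = left a ∷ left b ∷ right w ∷ right w' ∷ []
    quad-unique : Unique quad
    quad-unique = ((twins-≢ w ∘ ↑ˡ-injective W a b) ∷ ↑ˡ≢↑ʳ a w ∷ ↑ˡ≢↑ʳ a w' ∷ [])
             ∷ (↑ˡ≢↑ʳ b w ∷ ↑ˡ≢↑ʳ b w' ∷ [])
             ∷ ((w≢w' ∘ ↑ʳ-injective S w w') ∷ [])
             ∷ [] ∷ []
    blind : ∀ σ t → G (lookupᵥ quad σ) t (lookupᵥ quad (opposite₁ σ))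
                  ≡ G (lookupᵥ quad σ) t (lookupᵥ quad (opposite₂ σ))
    blind 0F t = subst (λ a' → G (left a) t (right w) ≡ G (left a') t (right w'))
                       (sym a≡) (funToFin-injective _ _ Ga≡ t)
    blind 1F t = subst (λ b' → G (left b) t (right w) ≡ G (left b') t (right w'))
                       (sym b≡) (funToFin-injective _ _ Gb≡ t)
    blind 2F t = twins-alike w t
    blind 3F t = subst₂ (λ a' b' → G (right w') t (left a') ≡ G (right w') t (left b'))
                        (sym a≡) (sym b≡) (twins-alike w' t)

trap : ∀ {k h S W} → k ^ h < S → S * (S * (k ^ h * (k ^ h * k ^ h))) < W →
       (F : Fin h → Fin (S + W) → Fin k) (G : Fin (S + W) → Fin h → Fin (S + W) → Fin k) → Trap F G
trap kʰ<S code<W F G with pigeonhole code<W (TrapConstruction.profile kʰ<S F G)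
... | w , w' , w<w' , same = TrapConstruction.trap-from kʰ<S F G w w' (<⇒≢ w<w') same

module Sunflower {r : ℕ} (H : Hypergraph r) {d : ℕ} (d<r : d < r) {m : ℕ}
  (sunflower : ContainsSunflowerWithCore d (2 + m) H) where

  Petal : Set
  Petal = Fin (2 + m)

  core : Subset (nV H)
  core = proj₁ sunflower

  ∣core∣≡d : ∣ core ∣ ≡ d
  ∣core∣≡d = proj₁ (proj₂ sunflower)

  edge : Petal → Subset (nV H)
  edge = proj₁ (proj₂ (proj₂ sunflower))

  edge∈H : ∀ σ → edge σ ∈ₗ edges H
  edge∈H = proj₁ (proj₂ (proj₂ (proj₂ sunflower)))

  edge∩edge : ∀ σ σ' → σ ≢ σ' → edge σ ∩ edge σ' ≡ core
  edge∩edge = proj₂ (proj₂ (proj₂ (proj₂ sunflower)))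

  petal : Petal → Subset (nV H)
  petal σ = edge σ ─ core

  ∣edge∣≡r : ∀ σ → ∣ edge σ ∣ ≡ r
  ∣edge∣≡r σ = All.lookup (uniform H) (edge∈H σ)

  another : Petal → Petal
  another zero    = 1F
  another (suc _) = zero

  σ≢another : ∀ σ → σ ≢ another σ
  σ≢another zero    ()
  σ≢another (suc _) ()

  core⊆edge : ∀ σ → core ⊆ edge σ
  core⊆edge σ x∈core =
    proj₁ (x∈p∩q⁻ (edge σ) (edge (another σ))
      (subst (_ ∈_) (sym (edge∩edge σ (another σ) (σ≢another σ))) x∈core))

  edge∩core≡core : ∀ σ → edge σ ∩ core ≡ core
  edge∩core≡core σ = ⊆-antisym (p∩q⊆q (edge σ) core) (λ x∈core → x∈p∩q⁺ (core⊆edge σ x∈core , x∈core))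

  r≡d+∣petal∣ : ∀ σ → r ≡ d + ∣ petal σ ∣
  r≡d+∣petal∣ σ = begin
    r                               ≡⟨ ∣edge∣≡r σ ⟨
    ∣ edge σ ∣                       ≡⟨ ∣p∣≡∣p∩q∣+∣p─q∣ (edge σ) core ⟩
    ∣ edge σ ∩ core ∣ + ∣ petal σ ∣   ≡⟨ cong (λ c → ∣ c ∣ + ∣ petal σ ∣) (edge∩core≡core σ) ⟩
    ∣ core ∣ + ∣ petal σ ∣            ≡⟨ cong (_+ ∣ petal σ ∣) ∣core∣≡d ⟩
    d + ∣ petal σ ∣                   ∎
    where open ≡-Reasoning

  ∣petal∣≡∣petal∣ : ∀ σ σ' → ∣ petal σ ∣ ≡ ∣ petal σ' ∣
  ∣petal∣≡∣petal∣ σ σ' = +-cancelˡ-≡ d _ _ (trans (sym (r≡d+∣petal∣ σ)) (r≡d+∣petal∣ σ'))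

  petal-owner : ∀ {x σ σ'} → x ∈ petal σ → x ∈ edge σ' → σ ≡ σ'
  petal-owner {x} {σ} {σ'} x∈petal x∈edge with σ ≟ σ'
  ... | yes σ≡σ' = σ≡σ'
  ... | no σ≢σ'  = ⊥-elim (x∈p─q⇒x∉q (edge σ) core x∈petal
                     (subst (x ∈_) (edge∩edge σ σ' σ≢σ') (x∈p∩q⁺ (p─q⊆p _ _ x∈petal , x∈edge))))

  edge-≢ : ∀ {σ σ'} → σ ≢ σ' → edge σ ≢ edge σ'
  edge-≢ {σ} {σ'} σ≢σ' edgeσ≡edgeσ' = <-irrefl d≡r d<r
    where
    core≡edge : core ≡ edge σ
    core≡edge = trans (sym (edge∩edge σ σ' σ≢σ'))
                      (trans (cong (edge σ ∩_) (sym edgeσ≡edgeσ')) (∩-idem (edge σ)))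
    d≡r : d ≡ r
    d≡r = trans (sym ∣core∣≡d) (trans (cong ∣_∣ core≡edge) (∣edge∣≡r σ))

  edgeIndex : Petal → Fin e[ H ]
  edgeIndex σ = Any.index (edge∈H σ)

  lookup-edgeIndex : ∀ σ → lookup (edges H) (edgeIndex σ) ≡ edge σ
  lookup-edgeIndex σ = sym (lookup-index (edge∈H σ))

  edgeIndex-≢ : ∀ {σ σ'} → σ ≢ σ' → edgeIndex σ ≢ edgeIndex σ'
  edgeIndex-≢ {σ} {σ'} σ≢σ' eq =
    edge-≢ σ≢σ' (trans (sym (lookup-edgeIndex σ)) (trans (cong (lookup (edges H)) eq) (lookup-edgeIndex σ')))

  data Place (x : Fin (nV H)) : Set where
    owned   : ∀ σ → x ∈ petal σ → Place x
    unowned : (∀ σ → x ∉ petal σ) → Place x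

  place : ∀ x → Place x
  place x with any? (λ σ → x ∈? petal σ)
  ... | yes (σ , x∈petal) = owned σ x∈petal
  ... | no ¬owned         = unowned (λ σ x∈petal → ¬owned (σ , x∈petal))

  unowned⇒∈core : ∀ {x σ} → (∀ σ → x ∉ petal σ) → x ∈ edge σ → x ∈ core
  unowned⇒∈core {x} {σ} x∉petals x∈edge with x ∈? core
  ... | yes x∈core = x∈core
  ... | no x∉core  = ⊥-elim (x∉petals σ (x∈p∧x∉q⇒x∈p─q x∈edge x∉core))

  offset : ∀ {x σ} → x ∈ petal σ → Fin (nV H)
  offset {x} {σ} x∈petal = fromℕ< (<-≤-trans (rank<∣p∣ x∈petal) (∣p∣≤n (petal σ)))

  module Copy {n M : ℕ} (room : suc M * nV H ≤ n) where

    slot : Fin (suc M) → Fin (nV H) → Fin n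
    slot i t = inject≤ (combine i t) room

    slot-injective : ∀ i t i' t' → slot i t ≡ slot i' t' → i ≡ i' × t ≡ t'
    slot-injective i t i' t' eq = combine-injective i t i' t' (inject≤-injective room room _ _ eq)

    base : Fin (nV H) → Fin n
    base = slot zero

    block : Fin M → Fin (nV H) → Fin n
    block j = slot (suc j)

    embedAt : (Petal → Fin M) → ∀ {x} → Place x → Fin n
    embedAt J     (owned σ x∈petal) = block (J σ) (offset x∈petal)
    embedAt J {x} (unowned _)       = base x

    embed : (Petal → Fin M) → Fin (nV H) → Fin n
    embed J x = embedAt J (place x)

    embedAt-owned : ∀ J {x σ} (p : Place x) (x∈petal : x ∈ petal σ) →
                    embedAt J p ≡ block (J σ) (offset x∈petal)
    embedAt-owned J (owned σ' x∈petal') x∈petal with petal-owner x∈petal' (p─q⊆p _ _ x∈petal)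
    ... | refl = refl
    embedAt-owned J (unowned x∉petals) x∈petal = ⊥-elim (x∉petals _ x∈petal)

    embedAt-unowned : ∀ J {x} (p : Place x) → (∀ σ → x ∉ petal σ) → embedAt J p ≡ base x
    embedAt-unowned J (owned σ x∈petal) x∉petals = ⊥-elim (x∉petals σ x∈petal)
    embedAt-unowned J (unowned _)       x∉petals = refl

    embedAt-injective : ∀ {J} → Injective _≡_ _≡_ J →
                        ∀ {x y} (p : Place x) (q : Place y) → embedAt J p ≡ embedAt J q → x ≡ y
    embedAt-injective J-inj (owned σ x∈petal) (owned σ' y∈petal) eq with slot-injective _ _ _ _ eq
    ... | Jσ≡Jσ' , offset≡ with J-inj (Fin.suc-injective Jσ≡Jσ')
    ...   | refl = rank-injective x∈petal y∈petal
                     (trans (sym (toℕ-fromℕ< _)) (trans (cong toℕ offset≡) (toℕ-fromℕ< _)))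
    embedAt-injective {J} J-inj (owned σ x∈petal) (unowned _) eq
      with slot-injective (suc (J σ)) (offset x∈petal) zero _ eq
    ... | () , _
    embedAt-injective {J} J-inj (unowned _) (owned σ y∈petal) eq
      with slot-injective zero _ (suc (J σ)) (offset y∈petal) eq
    ... | () , _
    embedAt-injective J-inj {x} {y} (unowned _) (unowned _) eq = proj₂ (slot-injective zero x zero y eq)

    embed-injective : ∀ {J} → Injective _≡_ _≡_ J → Injective _≡_ _≡_ (embed J)
    embed-injective J-inj {x} {y} = embedAt-injective J-inj (place x) (place y)

    embed-petal-vertex : ∀ J J' {σ σ' x} → J σ ≡ J' σ' → x ∈ petal σ →
                         ∃ λ x' → x' ∈ petal σ' × embed J' x' ≡ embed J x
    embed-petal-vertex J J' {σ} {σ'} {x} Jσ≡J'σ' x∈petal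
      with rank-surjective (petal σ') (subst (rank (petal σ) x <_) (∣petal∣≡∣petal∣ σ σ') (rank<∣p∣ x∈petal))
    ... | x' , x'∈petal , rank≡rank = x' , x'∈petal , (begin
      embed J' x'                       ≡⟨ embedAt-owned J' (place x') x'∈petal ⟩
      block (J' σ') (offset x'∈petal)   ≡⟨ cong₂ block (sym Jσ≡J'σ') (fromℕ<-cong _ _ rank≡rank _ _) ⟩
      block (J σ) (offset x∈petal)      ≡⟨ embedAt-owned J (place x) x∈petal ⟨
      embed J x                         ∎)
      where open ≡-Reasoning

    image-embed-⊆ : ∀ J J' σ σ' → J σ ≡ J' σ' → image (embed J) (edge σ) ⊆ image (embed J') (edge σ')
    image-embed-⊆ J J' σ σ' Jσ≡J'σ' y∈image with x∈image⁻ (embed J) y∈image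
    ... | x , x∈edge , refl = embed-x∈ (place x)
      where
      embed-x∈ : Place x → embed J x ∈ image (embed J') (edge σ')
      embed-x∈ (unowned x∉petals) =
        subst (_∈ image (embed J') (edge σ'))
              (trans (embedAt-unowned J' (place x) x∉petals) (sym (embedAt-unowned J (place x) x∉petals)))
              (x∈image⁺ (embed J') (core⊆edge σ' (unowned⇒∈core x∉petals x∈edge)))
      embed-x∈ (owned τ x∈petal) with petal-owner x∈petal x∈edge
      ... | refl with embed-petal-vertex J J' Jσ≡J'σ' x∈petal
      ...   | x' , x'∈petal , same-vertex =
        subst (_∈ image (embed J') (edge σ')) same-vertex (x∈image⁺ (embed J') (p─q⊆p _ _ x'∈petal))

    petalAt : Fin M → Subset n
    petalAt j = image (embed (λ _ → j)) (edge 0F)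

    image-embed : ∀ J σ → image (embed J) (edge σ) ≡ petalAt (J σ)
    image-embed J σ = ⊆-antisym (image-embed-⊆ J (λ _ → J σ) σ 0F refl)
                                (image-embed-⊆ (λ _ → J σ) J 0F σ refl)

    rainbow⇒petalAt-≢ : ∀ {k J} {c : Subset n → Fin k} → Rainbow H (embed J) c →
                        ∀ {σ σ'} → σ ≢ σ' → c (petalAt (J σ)) ≢ c (petalAt (J σ'))
    rainbow⇒petalAt-≢ {J = J} {c} rainbow {σ} {σ'} σ≢σ' same =
      rainbow (edgeIndex σ) (edgeIndex σ') (edgeIndex-≢ σ≢σ') (begin
        c (image (embed J) (lookup (edges H) (edgeIndex σ)))   ≡⟨ colour-of σ ⟩
        c (petalAt (J σ))                                      ≡⟨ same ⟩
        c (petalAt (J σ'))                                     ≡⟨ colour-of σ' ⟨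
        c (image (embed J) (lookup (edges H) (edgeIndex σ')))  ∎)
      where
      open ≡-Reasoning
      colour-of : ∀ τ → c (image (embed J) (lookup (edges H) (edgeIndex τ))) ≡ c (petalAt (J τ))
      colour-of τ = cong c (trans (cong (image (embed J)) (lookup-edgeIndex τ)) (image-embed J τ))

leftBlocks rightBlocks blocks : ℕ → ℕ
leftBlocks K  = suc K
rightBlocks K = suc (leftBlocks K * (leftBlocks K * (K * (K * K))))
blocks K      = leftBlocks K + rightBlocks K

module _ {r : ℕ} (H : Hypergraph r) {d : ℕ} (d<r : d < r) (sunflower : ContainsSunflowerWithCore d 4 H) where
  open Sunflower H d<r sunflower

  module _ {n k M : ℕ} (room : suc M * nV H ≤ n) (f : Fin n → Subset n → Fin k) where
    open Copy {M = M} room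

    baseColour : Fin (nV H) → Fin M → Fin k
    baseColour x j = f (base x) (petalAt j)

    blockColour : Fin M → Fin (nV H) → Fin M → Fin k
    blockColour i t j = f (block i t) (petalAt j)

    trap⇒blind-vertex : (T : Trap baseColour blockColour) → let open Trap T in
      ∀ x → ∃₂ λ σ σ' → σ ≢ σ' × f (embed J x) (petalAt (J σ)) ≡ f (embed J x) (petalAt (J σ'))
    trap⇒blind-vertex T x = blind-at (place x)
      where
      open Trap T
      blind-at : (p : Place x) →
                 ∃₂ λ σ σ' → σ ≢ σ' × f (embedAt J p) (petalAt (J σ)) ≡ f (embedAt J p) (petalAt (J σ'))
      blind-at (owned σ x∈petal) =
        opposite₁ σ , opposite₂ σ , opposite₁≢opposite₂ σ , block-blind σ (offset x∈petal)
      blind-at (unowned _)       = 2F , 3F , (λ ()) , base-blind x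

    trap⇒¬rainbow : (T : Trap baseColour blockColour) → let open Trap T in
      ∀ x → ¬ Rainbow H (embed J) (f (embed J x))
    trap⇒¬rainbow T x rainbow with trap⇒blind-vertex T x
    ... | σ , σ' , σ≢σ' , same =
      rainbow⇒petalAt-≢ {c = f (embed (Trap.J T) x)} rainbow σ≢σ' same

  no-local-coloring : ∀ {n k} → suc (blocks (k ^ nV H)) * nV H ≤ n → ¬ LocalColoring H n k
  no-local-coloring {n} {k} room (f , local) =
    uncurry (trap⇒¬rainbow {M = M} room f T) (local (embed J) (embed-injective {J = J} J-injective))
    where
    K M : ℕ
    K = k ^ nV H
    M = blocks K
    open Copy {M = M} room
    T : Trap (baseColour {M = M} room f) (blockColour {M = M} room f)
    T = trap {S = leftBlocks K} {W = rightBlocks K} (n<1+n K) (n<1+n _) _ _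
    open Trap T

  local-coloring⇒n<slots : ∀ {n k} → LocalColoring H n k → n < suc (blocks (k ^ nV H)) * nV H
  local-coloring⇒n<slots colouring = ≰⇒> (λ room → no-local-coloring room colouring)

^-distribʳ-* : ∀ m n o → (m * n) ^ o ≡ m ^ o * n ^ o
^-distribʳ-* m n zero    = refl
^-distribʳ-* m n (suc o) =
  trans (cong (m * n *_) (^-distribʳ-* m n o)) ([m*n]*[o*p]≡[m*o]*[n*p] m n (m ^ o) (n ^ o))

-- With K = 1 + x, the added polynomial is 8 K⁵ - suc (blocks K) in Horner form;
-- its coefficients are nonnegative.
blocks-bound : ∀ K → 1 ≤ K → suc (blocks K) ≤ 8 * K ^ 5
blocks-bound (suc x) _ = subst (suc (blocks (suc x)) ≤_) (expand x) (m≤m+n _ _)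
  where
  expand : ∀ x → suc (suc (suc x) + suc (suc (suc x) * (suc (suc x) * (suc x * (suc x * suc x)))))
                 + x * (23 + x * (55 + x * (61 + x * (33 + x * 7))))
               ≡ 8 * (suc x * (suc x * (suc x * (suc x * (suc x * 1)))))
  expand = solve-∀

m≤m^n : ∀ {m n} → 1 ≤ m → 1 ≤ n → m ≤ m ^ n
m≤m^n {suc m} {suc n} _ _ = m≤m*n (suc m) (suc m ^ n) {{m^n≢0 (suc m) n}}

slots-bound : ∀ {h k} → 1 ≤ h → 1 ≤ k → suc (blocks (k ^ h)) * h ≤ (h * 8 * k) ^ (h * 5)
slots-bound {h} {k@(suc _)} 1≤h _ = begin
  suc (blocks K) * h               ≡⟨ *-comm (suc (blocks K)) h ⟩
  h * suc (blocks K)               ≤⟨ *-monoʳ-≤ h (blocks-bound K (m^n>0 k h)) ⟩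
  h * (8 * K ^ 5)                  ≡⟨ *-assoc h 8 (K ^ 5) ⟨
  h * 8 * K ^ 5                    ≡⟨ cong (h * 8 *_) (^-*-assoc k h 5) ⟩
  h * 8 * k ^ (h * 5)              ≤⟨ *-monoˡ-≤ (k ^ (h * 5)) (m≤m^n (1≤h*c 8) (1≤h*c 5)) ⟩
  (h * 8) ^ (h * 5) * k ^ (h * 5)  ≡⟨ ^-distribʳ-* (h * 8) k (h * 5) ⟨
  (h * 8 * k) ^ (h * 5)            ∎
  where
  open ≤-Reasoning
  K : ℕ
  K = k ^ h
  1≤h*c : ∀ c .{{_ : NonZero c}} → 1 ≤ h * c
  1≤h*c c = ≤-trans 1≤h (m≤m*n h c)

theorem1p9 : (r : ℕ) → 2 ≤ r → (H : Hypergraph r) →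
    (∃ λ N → IsG r 4 N × N ≤ e[ H ]) →
    Σ ℕ λ p → Σ ℕ λ q → Σ ℕ λ d → Σ ℕ λ N0 →
      1 ≤ p × 1 ≤ q × 1 ≤ d ×
      (∀ n → N0 ≤ n → ∀ k → LocalColoring H n k → n ^ p ≤ (d * k) ^ q)
theorem1p9 r 2≤r H (N , (forces , _) , N≤e[H]) with forces H N≤e[H]
... | d , d<r , sunflower =
  1 , h * 5 , h * 8 , 1 , ≤-refl , ≤-trans 1≤h (m≤m*n h 5) , ≤-trans 1≤h (m≤m*n h 8) , bound
  where
  open Sunflower H d<r sunflower using (edge; ∣edge∣≡r)
  h : ℕ
  h = nV H
  1≤h : 1 ≤ h
  1≤h = ≤-trans (≤-trans (s≤s z≤n) 2≤r) (subst (_≤ h) (∣edge∣≡r 0F) (∣p∣≤n (edge 0F)))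
  bound : ∀ n → 1 ≤ n → ∀ k → LocalColoring H n k → n ^ 1 ≤ (h * 8 * k) ^ (h * 5)
  bound n@(suc _) _ k colouring@(f , _) = begin
    n ^ 1                     ≡⟨ ^-identityʳ n ⟩
    n                         ≤⟨ <⇒≤ (local-coloring⇒n<slots H d<r sunflower colouring) ⟩
    suc (blocks (k ^ h)) * h  ≤⟨ slots-bound 1≤h 1≤k ⟩
    (h * 8 * k) ^ (h * 5)     ∎
    where
    open ≤-Reasoning
    1≤k : 1 ≤ k
    1≤k = >-nonZero⁻¹ k {{nonZeroIndex (f zero ⁅ zero ⁆)}}
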